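{- If $\phi$ is bi-persistent, then $\mathsf{K}\phi$ is persistent and $\mathsf{L}\phi$ is anti-persistent; that is, if $\vdash_{\mathbf{MP}^*}(\phi\to\Box\phi)\land(\neg\phi\to\Box\neg\phi)$ then $\vdash_{\mathbf{MP}^*}\mathsf{K}\phi\to\Box\mathsf{K}\phi$ and $\vdash_{\mathbf{MP}^*}\neg\mathsf{L}\phi\to\Box\neg\mathsf{L}\phi$.
   Context: Formulas: built from a countable set $\mathsf{A}$ of atomic formulas (containing $\top,\bot$) by $\land,\neg,\Box,\mathsf{K}$; $\Diamond\phi:=\neg\Box\neg\phi$, $\mathsf{L}\phi:=\neg\mathsf{K}\neg\phi$. A formula $\phi$ is persistent if $\phi\to\Box\phi$ is a theorem, anti-persistent if $\neg\phi\to\Box\neg\phi$ is a theorem, bi-persistent if both are. The system $\mathbf{MP}^*$ has rules modus ponens, $\mathsf{K}$-necessitation, $\Box$-necessitation and axioms all instances of: (1) propositional tautologies; (2) $(A\to\Box A)\land(\neg A\to\Box\neg A)$ for atomic $A$; (3) $\Box(\phi\to\psi)\to(\Box\phi\to\Box\psi)$; (4) $\Box\phi\to\phi$; (5) $\Box\phi\to\Box\Box\phi$; (6) $\mathsf{K}(\phi\to\psi)\to(\mathsf{K}\phi\to\mathsf{K}\psi)$; (7) $\mathsf{K}\phi\to\phi$; (8) $\mathsf{K}\phi\to\mathsf{K}\mathsf{K}\phi$; (9) $\phi\to\mathsf{K}\mathsf{L}\phi$; (10) $\mathsf{K}\Box\phi\to\Box\mathsf{K}\phi$; (11) $\Diamond\Box\phi\to\Box\Diamond\phi$;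 (12) $\Diamond(\mathsf{K}\phi\land\psi)\land\mathsf{L}\Diamond(\mathsf{K}\phi\land\chi)\to\Diamond(\mathsf{K}\Diamond\phi\land\Diamond\psi\land\mathsf{L}\Diamond\chi)$. -}

module Defs where

open import Data.Nat using (ℕ)
open import Data.Bool using (Bool; true; false; _∧_; not)
open import Relation.Binary.PropositionalEquality using (_≡_)

data Formula : Set where
  atom : ℕ → Formula
  ⊤'   : Formula
  ⊥'   : Formula
  _∧'_ : Formula → Formula → Formula
  ¬'_  : Formula → Formula
  □_   : Formula → Formula
  K_   : Formula → Formula

infixr 6 _∧'_
infixr 4 _→'_
infix 7 ¬'_ □_ K_ ◇_ L_

data Atomic : Formula → Set where
  atomA : ∀ n → Atomic (atom n)
  topA  : Atomic ⊤'
  botA  : Atomic ⊥'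

_∨'_ : Formula → Formula → Formula
φ ∨' ψ = ¬' (¬' φ ∧' ¬' ψ)

_→'_ : Formula → Formula → Formula
φ →' ψ = ¬' (φ ∧' ¬' ψ)

◇_ : Formula → Formula
◇ φ = ¬' □ ¬' φ

L_ : Formula → Formula
L φ = ¬' K ¬' φ

-- Propositional tautologies: formulas true under every Boolean valuation,
-- where the "propositional variables" are the atoms and the modal formulas
-- □ψ, Kψ, and ⊤/⊥ get their fixed truth values.
record Valuation : Set where
  field
    vAtom : ℕ → Bool
    vBox  : Formula → Bool
    vK    : Formula → Bool

eval : Valuation → Formula → Bool
eval v (atom n) = Valuation.vAtom v n
eval v ⊤' = true
eval v ⊥' = false
eval v (φ ∧' ψ) = eval v φ ∧ eval v ψ
eval v (¬' φ) = not (eval v φ)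
eval v (□ φ) = Valuation.vBox v φ
eval v (K φ) = Valuation.vK v φ

Tautology : Formula → Set
Tautology φ = ∀ (v : Valuation) → eval v φ ≡ true

data ⊢_ : Formula → Set where
  taut   : ∀ {φ} → Tautology φ → ⊢ φ
  mp     : ∀ {φ ψ} → ⊢ (φ →' ψ) → ⊢ φ → ⊢ ψ
  necK   : ∀ {φ} → ⊢ φ → ⊢ K φ
  nec□   : ∀ {φ} → ⊢ φ → ⊢ □ φ
  ax2    : ∀ {A} → Atomic A → ⊢ ((A →' □ A) ∧' (¬' A →' □ ¬' A))
  ax3    : ∀ {φ ψ} → ⊢ (□ (φ →' ψ) →' (□ φ →' □ ψ))
  ax4    : ∀ {φ} → ⊢ (□ φ →' φ)
  ax5    : ∀ {φ} → ⊢ (□ φ →' □ □ φ)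
  ax6    : ∀ {φ ψ} → ⊢ (K (φ →' ψ) →' (K φ →' K ψ))
  ax7    : ∀ {φ} → ⊢ (K φ →' φ)
  ax8    : ∀ {φ} → ⊢ (K φ →' K K φ)
  ax9    : ∀ {φ} → ⊢ (φ →' K L φ)
  ax10   : ∀ {φ} → ⊢ (K □ φ →' □ K φ)
  ax11   : ∀ {φ} → ⊢ (◇ □ φ →' □ ◇ φ)
  ax12   : ∀ {φ ψ χ} →
           ⊢ ((◇ (K φ ∧' ψ) ∧' L ◇ (K φ ∧' χ)) →'
              ◇ (K ◇ φ ∧' ◇ ψ ∧' L ◇ χ))

infix 2 ⊢_

{-# OPTIONS --safe #-}
-- K commutes into □ by axiom 10, so K preserves persistence: Kφ → K□φ → □Kφ.
-- Since ¬Lφ is ¬¬K¬φ, anti-persistence of Lφ is persistence of K¬φ up to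
-- double negation, and K¬φ is persistent because ¬φ is.
module Submission where

open import Data.Bool using (Bool; true; false; _∧_; not)
open import Data.Product using (_×_; _,_)
open import Defs
open import Relation.Binary.PropositionalEquality using (_≡_; refl)

infixr 5 _⇒ᵇ_

_⇒ᵇ_ : Bool → Bool → Bool
a ⇒ᵇ b = not (a ∧ not b)

⇒ᵇ-trans-valid : ∀ a b c → (a ⇒ᵇ b) ⇒ᵇ (b ⇒ᵇ c) ⇒ᵇ (a ⇒ᵇ c) ≡ true
⇒ᵇ-trans-valid true  true  true  = refl
⇒ᵇ-trans-valid true  true  false = refl
⇒ᵇ-trans-valid true  false true  = refl
⇒ᵇ-trans-valid true  false false = refl
⇒ᵇ-trans-valid false true  true  = refl
⇒ᵇ-trans-valid false true  false = refl
⇒ᵇ-trans-valid false false true  = refl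
⇒ᵇ-trans-valid false false false = refl

∧-⇒ᵇ-left-valid : ∀ a b → (a ∧ b) ⇒ᵇ a ≡ true
∧-⇒ᵇ-left-valid true  true  = refl
∧-⇒ᵇ-left-valid true  false = refl
∧-⇒ᵇ-left-valid false b     = refl

∧-⇒ᵇ-right-valid : ∀ a b → (a ∧ b) ⇒ᵇ b ≡ true
∧-⇒ᵇ-right-valid true  true  = refl
∧-⇒ᵇ-right-valid true  false = refl
∧-⇒ᵇ-right-valid false true  = refl
∧-⇒ᵇ-right-valid false false = refl

¬¬-elim-valid : ∀ a → not (not a) ⇒ᵇ a ≡ true
¬¬-elim-valid true  = refl
¬¬-elim-valid false = refl

¬¬-intro-valid : ∀ a → a ⇒ᵇ not (not a) ≡ true
¬¬-intro-valid true  = refl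
¬¬-intro-valid false = refl

module _ {φ ψ : Formula} where

  ⊢-∧-elimˡ : ⊢ (φ ∧' ψ) → ⊢ φ
  ⊢-∧-elimˡ = mp (taut λ v → ∧-⇒ᵇ-left-valid (eval v φ) (eval v ψ))

  ⊢-∧-elimʳ : ⊢ (φ ∧' ψ) → ⊢ ψ
  ⊢-∧-elimʳ = mp (taut λ v → ∧-⇒ᵇ-right-valid (eval v φ) (eval v ψ))

  ⊢-K-mono : ⊢ (φ →' ψ) → ⊢ (K φ →' K ψ)
  ⊢-K-mono φ→ψ = mp ax6 (necK φ→ψ)

  ⊢-□-mono : ⊢ (φ →' ψ) → ⊢ (□ φ →' □ ψ)
  ⊢-□-mono φ→ψ = mp ax3 (nec□ φ→ψ)

⊢-→-trans : ∀ {φ ψ χ} → ⊢ (φ →' ψ) → ⊢ (ψ →' χ) → ⊢ (φ →' χ)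
⊢-→-trans {φ} {ψ} {χ} φ→ψ ψ→χ =
  mp (mp (taut λ v → ⇒ᵇ-trans-valid (eval v φ) (eval v ψ) (eval v χ)) φ→ψ) ψ→χ

⊢-¬¬-elim : ∀ φ → ⊢ (¬' ¬' φ →' φ)
⊢-¬¬-elim φ = taut λ v → ¬¬-elim-valid (eval v φ)

⊢-¬¬-intro : ∀ φ → ⊢ (φ →' ¬' ¬' φ)
⊢-¬¬-intro φ = taut λ v → ¬¬-intro-valid (eval v φ)

Persistent : Formula → Set
Persistent φ = ⊢ (φ →' □ φ)

AntiPersistent : Formula → Set
AntiPersistent φ = Persistent (¬' φ)

persistent-resp-⇔ : ∀ {φ ψ} → ⊢ (φ →' ψ) → ⊢ (ψ →' φ) →
                    Persistent φ → Persistent ψ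
persistent-resp-⇔ φ→ψ ψ→φ φ-pers = ⊢-→-trans ψ→φ (⊢-→-trans φ-pers (⊢-□-mono φ→ψ))

persistent-¬¬ : ∀ {φ} → Persistent φ → Persistent (¬' ¬' φ)
persistent-¬¬ {φ} = persistent-resp-⇔ (⊢-¬¬-intro φ) (⊢-¬¬-elim φ)

persistent-K : ∀ {φ} → Persistent φ → Persistent (K φ)
persistent-K φ-pers = ⊢-→-trans (⊢-K-mono φ-pers) ax10

antiPersistent-L : ∀ {φ} → AntiPersistent φ → AntiPersistent (L φ)
antiPersistent-L ¬φ-pers = persistent-¬¬ (persistent-K ¬φ-pers)

mainTheorem11 : ∀ (φ : Formula) →
    ⊢ ((φ →' □ φ) ∧' (¬' φ →' □ ¬' φ)) →
    (⊢ (K φ →' □ K φ)) × (⊢ (¬' L φ →' □ ¬' L φ))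
mainTheorem11 φ biPersistent =
  persistent-K (⊢-∧-elimˡ biPersistent) , antiPersistent-L (⊢-∧-elimʳ biPersistent)
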